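{- Let $M\subseteq\mathbb{T}$ be a model satisfying the standing hypothesis below. Then for all $S,S_1,S_2\subseteq\mathbb{S}$: (1) $\alpha^\forall_M(\boldsymbol{\sigma}_S)=S$; (2) if $M=\mathscr{M}_\to$ for a total transition system $\langle\mathbb{S},\to\rangle$, then for every $t\subseteq\mathbb{S}\times\mathbb{S}$, $\alpha^\forall_{M}(\boldsymbol{\pi}_t)=\{s\in\mathbb{S}\mid \forall s'\in\mathbb{S}.\ s\to s'\Rightarrow (s,s')\in t\}$; (3) $\alpha^\forall_M(\gamma^\forall_M(S_1)\cup\gamma^\forall_M(S_2))=S_1\cup S_2$; (4) $\alpha^\forall_M(\neg\,\gamma^\forall_M(S))=\mathbb{S}\setminus S$; (5) if $M=\mathscr{M}_\to$ for a total transition system $\langle\mathbb{S},\to\rangle$, then $\alpha^\forall_M(\oplus(\gamma^\forall_M(S)))=\widetilde{\mathrm{pre}}_\to(S)$, where $\widetilde{\mathrm{pre}}_\to(S)=\{a\in\mathbb{S}\mid\forall b\in\mathbb{S}.\ a\to b\Rightarrow b\in S\}$; (6) $\alpha^\forall_M(\curvearrowleft(\gamma^\forall_M(S)))=\{s\in S\mid M_{\downarrow s}=(\curvearrowleft M)_{\downarrow s}\}$; (7) $\alpha^\forall_M(\boldsymbol{\forall}(\gamma^\forall_M(S_1),\gamma^\forall_M(S_2)))=S_1\cap S_2$.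
   Context: $\mathbb{S}$ is a set of states; a trace is a pair $\langle i,\sigma\rangle$ with $i\in\mathbb{Z}$ (present time) and $\sigma:\mathbb{Z}\to\mathbb{S}$, writing $\sigma_k=\sigma(k)$; $\mathbb{T}$ is the set of all traces. For $X\subseteq\mathbb{T}$ and $s\in\mathbb{S}$, $X_{\downarrow s}=\{\langle i,\sigma\rangle\in X\mid\sigma_i=s\}$; $\neg X=\mathbb{T}\setminus X$. Trace transformers: $\oplus(X)=\{\langle i,\sigma\rangle\in\mathbb{T}\mid\langle i+1,\sigma\rangle\in X\}$, $\ominus(X)=\{\langle i,\sigma\rangle\in\mathbb{T}\mid\langle i-1,\sigma\rangle\in X\}$, $\curvearrowleft(X)=\{\langle -i,\lambda k.\sigma_{ -k}\rangle\mid\langle i,\sigma\rangle\in X\}$; for $S\subseteq\mathbb{S}$, $\boldsymbol{\sigma}_S=\{\langle i,\sigma\rangle\in\mathbb{T}\mid\sigma_i\in S\}$; for $t\subseteq\mathbb{S}\times\mathbb{S}$, $\boldsymbol{\pi}_t=\{\langle i,\sigma\rangle\in\mathbb{T}\mid(\sigma_i,\sigma_{i+1})\in t\}$; $\boldsymbol{\forall}(X,Y)=\{\langle i,\sigma\rangle\in X\mid X_{\downarrow\sigma_i}\subseteq Y\}$. A total transition system is $\langle\mathbb{S},\to\rangle$ with $\to\subseteq\mathbb{S}\times\mathbb{S}$ such that every state has at least one successor and at least one predecessor; its model is $\mathscr{M}_\to=\{\langle i,\sigma\rangle\in\mathbb{T}\mid\forall k\in\mathbb{Z}.\ \sigma_k\to\sigma_{k+1}\}$.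 Universal abstraction/concretization for a model $M\subseteq\mathbb{T}$: $\alpha^\forall_M(X)=\{s\in\mathbb{S}\mid M_{\downarrow s}\subseteq X\}$ for $X\subseteq\mathbb{T}$, and $\gamma^\forall_M(S)=\{\langle i,\sigma\rangle\in M\mid\sigma_i\in S\}$ for $S\subseteq\mathbb{S}$. Standing hypothesis on $M$: (i) $|M_{\downarrow s}|>1$ for every $s\in\mathbb{S}$; (ii) $\oplus(M)=M=\ominus(M)$ and $\oplus(\curvearrowleft M)=\curvearrowleft M=\ominus(\curvearrowleft M)$ (these hold for $\mathscr{M}_\to$ of any total transition system). -}

module Defs where

open import Level using (0ℓ)
open import Data.Integer using (ℤ; -_; _+_; _-_; 1ℤ)
open import Data.Product using (Σ; ∃; _×_; _,_; proj₁; proj₂)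
open import Relation.Binary.PropositionalEquality using (_≡_)
open import Relation.Binary.Core using (Rel)
open import Relation.Nullary using (¬_)
open import Relation.Unary using (Pred; _∈_; _⊆_; _≐_; ∁)

-- A trace ⟨ i , σ ⟩ : present time i, bi-infinite state sequence σ.
Trace : Set → Set
Trace 𝕊 = ℤ × (ℤ → 𝕊)

TSet : Set → Set₁
TSet 𝕊 = Pred (Trace 𝕊) 0ℓ

SSet : Set → Set₁
SSet 𝕊 = Pred 𝕊 0ℓ

module _ {𝕊 : Set} where

  -- extensional (pointwise) equality of traces (no funext in Agda)
  _≈ₜ_ : Trace 𝕊 → Trace 𝕊 → Set
  (i , σ) ≈ₜ (j , τ) = (i ≡ j) × (∀ k → σ k ≡ τ k)

  now : Trace 𝕊 → 𝕊
  now (i , σ) = σ i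

  _↓_ : TSet 𝕊 → 𝕊 → TSet 𝕊
  (X ↓ s) tr = tr ∈ X × now tr ≡ s

  ⊕ : TSet 𝕊 → TSet 𝕊
  ⊕ X (i , σ) = (i + 1ℤ , σ) ∈ X

  ⊖ : TSet 𝕊 → TSet 𝕊
  ⊖ X (i , σ) = (i - 1ℤ , σ) ∈ X

  rev : Trace 𝕊 → Trace 𝕊
  rev (i , σ) = (- i , λ k → σ (- k))

  -- ↶ X = { rev t | t ∈ X }  (image, up to pointwise trace equality)
  ↶ : TSet 𝕊 → TSet 𝕊
  ↶ X u = Σ (Trace 𝕊) λ t → t ∈ X × u ≈ₜ rev t

  σ[_] : SSet 𝕊 → TSet 𝕊
  σ[ S ] (i , σ) = σ i ∈ S

  π[_] : Rel 𝕊 0ℓ → TSet 𝕊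
  π[ t ] (i , σ) = t (σ i) (σ (i + 1ℤ))

  ∀[_,_] : TSet 𝕊 → TSet 𝕊 → TSet 𝕊
  ∀[ X , Y ] tr = tr ∈ X × ((X ↓ now tr) ⊆ Y)

  Total : Rel 𝕊 0ℓ → Set
  Total _⟶_ = (∀ s → ∃ λ s' → s ⟶ s') × (∀ s → ∃ λ s' → s' ⟶ s)

  Model : Rel 𝕊 0ℓ → TSet 𝕊
  Model _⟶_ (i , σ) = ∀ k → σ k ⟶ σ (k + 1ℤ)

  α∀ : TSet 𝕊 → TSet 𝕊 → SSet 𝕊
  α∀ M X s = (M ↓ s) ⊆ X

  γ∀ : TSet 𝕊 → SSet 𝕊 → TSet 𝕊
  γ∀ M S tr = tr ∈ M × now tr ∈ S

  pre~ : Rel 𝕊 0ℓ → SSet 𝕊 → SSet 𝕊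
  pre~ _⟶_ S a = ∀ b → a ⟶ b → b ∈ S

  -- M is closed under pointwise trace equality (automatic with funext;
  -- needed since Agda predicates on function-containing traces need not be)
  Extensional : TSet 𝕊 → Set
  Extensional M = ∀ {t u} → t ≈ₜ u → t ∈ M → u ∈ M

  -- |M_{↓ s}| > 1 : two distinct (pointwise) traces in M_{↓ s}
  MoreThanOne : TSet 𝕊 → Set
  MoreThanOne X = Σ (Trace 𝕊) λ t → Σ (Trace 𝕊) λ u →
                    t ∈ X × u ∈ X × ¬ (t ≈ₜ u)

  Standing : TSet 𝕊 → Set
  Standing M = Extensional M
             × (∀ s → MoreThanOne (M ↓ s))
             × (⊕ M ≐ M) × (M ≐ ⊖ M)
             × (⊕ (↶ M) ≐ ↶ M) × (↶ M ≐ ⊖ (↶ M))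

{-# OPTIONS --safe #-}
-- A trace property that, on traces of M, depends only on the present state is
-- abstracted by α∀_M to exactly that state property, because every state is the
-- present state of some trace of M; this gives (1), (3), (4) and (7).  For (2)
-- and (5) the property depends on the present and the next state, and every
-- transition of a total system lies on a bi-infinite trace of its model.  For
-- (6), time reversal keeps the present state and is an involution, so the
-- reversed concretization covers M↓s only when M↓s and (↶ M)↓s coincide.
module Submission where

open import Defs
open import Level using (0ℓ)
open import Data.Product using (_×_; _,_; proj₁; proj₂; ∃)
open import Data.Sum using (inj₁; inj₂; [_,_])
open import Data.Nat using (zero; suc)
import Data.Nat.Properties as ℕ
open import Data.Nat.GeneralisedArithmetic using (iterate)
open import Data.Integer using (ℤ; +_; -[1+_]; 0ℤ; 1ℤ; -_; _+_)
open import Data.Integer.Properties using (neg-involutive)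
open import Function using (flip)
open import Relation.Binary.Core using (Rel)
open import Relation.Binary.PropositionalEquality
  using (_≡_; refl; sym; trans; cong; subst; subst₂)
open import Relation.Unary using (_∈_; _⊆_; _≐_; ∁; _∪_; _∩_; Satisfiable)
open import Relation.Unary.Properties using (≐-trans)

module _ {𝕊 : Set} where

  iterate-step : {_∼_ : Rel 𝕊 0ℓ} {f : 𝕊 → 𝕊} → (∀ x → x ∼ f x) →
                 ∀ x n → iterate f x n ∼ iterate f x (suc n)
  iterate-step           step x zero    = step x
  iterate-step {_∼_} {f} step x (suc n) = iterate-step {_∼_} {f} step (f x) n

  module _ {_⟶_ : Rel 𝕊 0ℓ} (total : Total _⟶_) where

    edge-in-Model : ∀ {a b} → a ⟶ b →
                    ∃ λ σ → (0ℤ , σ) ∈ Model _⟶_ × σ 0ℤ ≡ a × σ 1ℤ ≡ b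
    edge-in-Model {a} {b} a⟶b = σ , step , refl , refl
      where
      next prev : 𝕊 → 𝕊
      next s = proj₁ (proj₁ total s)
      prev s = proj₁ (proj₂ total s)

      σ : ℤ → 𝕊
      σ (+ zero)  = a
      σ (+ suc n) = iterate next b n
      σ -[1+ n ]  = iterate prev a (suc n)

      step : ∀ k → σ k ⟶ σ (k + 1ℤ)
      step (+ zero)       = a⟶b
      step (+ suc n) rewrite ℕ.+-comm n 1 =
        iterate-step {_∼_ = _⟶_} (λ s → proj₂ (proj₁ total s)) b n
      step -[1+ zero ]    = proj₂ (proj₂ total a)
      step -[1+ suc n ]   =
        iterate-step {_∼_ = flip _⟶_} (λ s → proj₂ (proj₂ total s)) a (suc n)

  now-rev : ∀ {t u : Trace 𝕊} → t ≈ₜ rev u → now t ≡ now u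
  now-rev {i , σ} {j , τ} (i≡-j , σ≗τ∘-) =
    trans (σ≗τ∘- i) (cong τ (trans (cong -_ i≡-j) (neg-involutive j)))

  ↶-↶-⊆ : {X : TSet 𝕊} → Extensional X → ↶ (↶ X) ⊆ X
  ↶-↶-⊆ ext ((j , τ) , ((k , ρ) , v∈X , (j≡-k , τ≗ρ∘-)) , (i≡-j , σ≗τ∘-)) =
    ext ( trans (trans (sym (neg-involutive k)) (cong -_ (sym j≡-k))) (sym i≡-j)
        , λ n → sym (trans (σ≗τ∘- n) (trans (τ≗ρ∘- (- n)) (cong ρ (neg-involutive n)))) )
        v∈X

  ↶-γ∀ : (M : TSet 𝕊) (S : SSet 𝕊) → ↶ (γ∀ M S) ≐ γ∀ (↶ M) S
  ↶-γ∀ M S =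
      (λ (u , (u∈M , u∈S) , t≈) → (u , u∈M , t≈) , subst S (sym (now-rev {u = u} t≈)) u∈S)
    , (λ ((u , u∈M , t≈) , t∈S) → u , (u∈M , subst S (now-rev {u = u} t≈) t∈S) , t≈)

  ↓-⊆-↶⇒≐ : {M : TSet 𝕊} → Extensional M →
            ∀ {s} → (M ↓ s) ⊆ (↶ M ↓ s) → (M ↓ s) ≐ (↶ M ↓ s)
  ↓-⊆-↶⇒≐ ext M↓s⊆ = M↓s⊆ , λ ((u , u∈M , t≈) , t↦s) →
    ↶-↶-⊆ ext (u , proj₁ (M↓s⊆ (u∈M , trans (sym (now-rev {u = u} t≈)) t↦s)) , t≈) , t↦s

  α∀-cong : (M : TSet 𝕊) {X Y : TSet 𝕊} → X ≐ Y → α∀ M X ≐ α∀ M Y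
  α∀-cong M (X⊆Y , Y⊆X) = (λ M↓s⊆X t∈M↓s → X⊆Y (M↓s⊆X t∈M↓s))
                        , (λ M↓s⊆Y t∈M↓s → Y⊆X (M↓s⊆Y t∈M↓s))

  module _ {M : TSet 𝕊} (nonempty : ∀ s → Satisfiable (M ↓ s)) where

    α∀-state : {X : TSet 𝕊} {P : SSet 𝕊} →
               (∀ {t} → t ∈ M → t ∈ X → now t ∈ P) →
               (∀ {t} → t ∈ M → now t ∈ P → t ∈ X) →
               α∀ M X ≐ P
    α∀-state {P = P} X⇒P P⇒X =
        (λ {s} M↓s⊆X → let (w , w∈M , w↦s) = nonempty s in
                       subst P w↦s (X⇒P w∈M (M↓s⊆X (w∈M , w↦s))))
      , (λ s∈P (t∈M , t↦s) → P⇒X t∈M (subst P (sym t↦s) s∈P))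

    α∀-σ : (S : SSet 𝕊) → α∀ M σ[ S ] ≐ S
    α∀-σ S = α∀-state (λ _ t∈S → t∈S) (λ _ t∈S → t∈S)

    α∀-γ∀-∪ : (S₁ S₂ : SSet 𝕊) → α∀ M (γ∀ M S₁ ∪ γ∀ M S₂) ≐ (S₁ ∪ S₂)
    α∀-γ∀-∪ S₁ S₂ =
      α∀-state (λ _ → [ (λ t∈γ → inj₁ (proj₂ t∈γ)) , (λ t∈γ → inj₂ (proj₂ t∈γ)) ])
               (λ t∈M → [ (λ t∈S₁ → inj₁ (t∈M , t∈S₁)) , (λ t∈S₂ → inj₂ (t∈M , t∈S₂)) ])

    α∀-∁-γ∀ : (S : SSet 𝕊) → α∀ M (∁ (γ∀ M S)) ≐ ∁ S
    α∀-∁-γ∀ S = α∀-state (λ t∈M t∉γ t∈S → t∉γ (t∈M , t∈S))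
                         (λ _ t∉S t∈γ → t∉S (proj₂ t∈γ))

    α∀-∀-γ∀ : (S₁ S₂ : SSet 𝕊) → α∀ M ∀[ γ∀ M S₁ , γ∀ M S₂ ] ≐ (S₁ ∩ S₂)
    α∀-∀-γ∀ S₁ S₂ =
      α∀-state (λ _ (t∈γ₁ , γ₁↓⊆γ₂) → proj₂ t∈γ₁ , proj₂ (γ₁↓⊆γ₂ (t∈γ₁ , refl)))
               (λ t∈M (t∈S₁ , t∈S₂) → (t∈M , t∈S₁)
                                     , λ (u∈γ₁ , u↦t) → proj₁ u∈γ₁ , subst S₂ (sym u↦t) t∈S₂)

    α∀-γ∀ : (N : TSet 𝕊) (S : SSet 𝕊) → α∀ M (γ∀ N S) ≐ (λ s → s ∈ S × (M ↓ s) ⊆ (N ↓ s))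
    α∀-γ∀ N S =
        (λ {s} M↓s⊆γ → let (w , w∈M↓s@(_ , w↦s)) = nonempty s in
                       subst S w↦s (proj₂ (M↓s⊆γ w∈M↓s))
                     , λ t∈M↓s@(_ , t↦s) → proj₁ (M↓s⊆γ t∈M↓s) , t↦s)
      , (λ (s∈S , M↓s⊆N↓s) t∈M↓s@(_ , t↦s) →
           proj₁ (M↓s⊆N↓s t∈M↓s) , subst S (sym t↦s) s∈S)

    α∀-↶-γ∀ : Extensional M → (S : SSet 𝕊) →
              α∀ M (↶ (γ∀ M S)) ≐ (λ s → s ∈ S × (M ↓ s) ≐ (↶ M ↓ s))
    α∀-↶-γ∀ ext S = ≐-trans (α∀-cong M (↶-γ∀ M S)) (≐-trans (α∀-γ∀ (↶ M) S)
      ( (λ (s∈S , M↓s⊆) → s∈S , ↓-⊆-↶⇒≐ ext M↓s⊆)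
      , (λ (s∈S , M↓s≐) → s∈S , proj₁ M↓s≐) ))

  module _ {_⟶_ : Rel 𝕊 0ℓ} (total : Total _⟶_) {M : TSet 𝕊} (M≐Model : M ≐ Model _⟶_) where

    α∀-next : {X : TSet 𝕊} {R : Rel 𝕊 0ℓ} →
              (∀ {i σ} → (i , σ) ∈ M → (i , σ) ∈ X → R (σ i) (σ (i + 1ℤ))) →
              (∀ {i σ} → (i , σ) ∈ M → R (σ i) (σ (i + 1ℤ)) → (i , σ) ∈ X) →
              α∀ M X ≐ (λ s → ∀ s' → s ⟶ s' → R s s')
    α∀-next {X} {R} X⇒R R⇒X = to , from
      where
      to : α∀ M X ⊆ (λ s → ∀ s' → s ⟶ s' → R s s')
      to M↓s⊆X _ s⟶s' with edge-in-Model total s⟶s'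
      ... | σ , σ∈Model , σ0≡s , σ1≡s' =
        subst₂ R σ0≡s σ1≡s' (X⇒R σ∈M (M↓s⊆X (σ∈M , σ0≡s)))
        where
        σ∈M : (0ℤ , σ) ∈ M
        σ∈M = proj₂ M≐Model σ∈Model

      from : (λ s → ∀ s' → s ⟶ s' → R s s') ⊆ α∀ M X
      from {s} R-succ {i , σ} (σ∈M , σi≡s) =
        R⇒X σ∈M (subst (λ a → R a (σ (i + 1ℤ))) (sym σi≡s) (R-succ _ s⟶next))
        where
        s⟶next : s ⟶ σ (i + 1ℤ)
        s⟶next = subst (_⟶ σ (i + 1ℤ)) σi≡s (proj₁ M≐Model σ∈M i)

    α∀-π : (t : Rel 𝕊 0ℓ) → α∀ M π[ t ] ≐ (λ s → ∀ s' → s ⟶ s' → t s s')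
    α∀-π t = α∀-next (λ _ σ∈π → σ∈π) (λ _ σ∈π → σ∈π)

    -- membership in Model _⟶_ does not depend on the present time
    α∀-⊕-γ∀ : (S : SSet 𝕊) → α∀ M (⊕ (γ∀ M S)) ≐ pre~ _⟶_ S
    α∀-⊕-γ∀ S = α∀-next (λ _ → proj₂)
                        (λ σ∈M next∈S → proj₂ M≐Model (proj₁ M≐Model σ∈M) , next∈S)

MoreThanOne⇒Satisfiable : {A : Set} {X : TSet A} → MoreThanOne X → Satisfiable X
MoreThanOne⇒Satisfiable (t , _ , t∈X , _) = t , t∈X

lemma1 : {𝕊 : Set} (M : TSet 𝕊) → Standing M →
    ((S : SSet 𝕊) → α∀ M σ[ S ] ≐ S)
    × ((_⟶_ : Rel 𝕊 0ℓ) → Total _⟶_ → M ≐ Model _⟶_ →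
         (t : Rel 𝕊 0ℓ) →
         α∀ M π[ t ] ≐ (λ s → ∀ s' → s ⟶ s' → t s s'))
    × ((S₁ S₂ : SSet 𝕊) → α∀ M (γ∀ M S₁ ∪ γ∀ M S₂) ≐ (S₁ ∪ S₂))
    × ((S : SSet 𝕊) → α∀ M (∁ (γ∀ M S)) ≐ ∁ S)
    × ((_⟶_ : Rel 𝕊 0ℓ) → Total _⟶_ → M ≐ Model _⟶_ →
         (S : SSet 𝕊) → α∀ M (⊕ (γ∀ M S)) ≐ pre~ _⟶_ S)
    × ((S : SSet 𝕊) →
         α∀ M (↶ (γ∀ M S)) ≐ (λ s → s ∈ S × (M ↓ s) ≐ (↶ M ↓ s)))
    × ((S₁ S₂ : SSet 𝕊) →
         α∀ M ∀[ γ∀ M S₁ , γ∀ M S₂ ] ≐ (S₁ ∩ S₂))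
lemma1 M (ext , moreThanOne , _) =
    α∀-σ nonempty
  , (λ _ total M≐Model → α∀-π total M≐Model)
  , α∀-γ∀-∪ nonempty
  , α∀-∁-γ∀ nonempty
  , (λ _ total M≐Model → α∀-⊕-γ∀ total M≐Model)
  , α∀-↶-γ∀ nonempty ext
  , α∀-∀-γ∀ nonempty
  where
  nonempty : ∀ s → Satisfiable (M ↓ s)
  nonempty s = MoreThanOne⇒Satisfiable (moreThanOne s)
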